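{- Let $n\ge2$ and let $A$, $B$, $C$ be $m \times n$ matrices over $\{ -1,0,1\}$ such that $A$ has an entry $0$ and $(A,B,C)$ is neither independent from $B$ nor independent from $C$. Then ${\rm IST}(A,B,C)$ is finite in each of the following cases: (1) $01^{n-1}$ and $1^{n-1}0$ are rows of $A$; (2) $0(-1)^{n-1}$ and $(-1)^{n-1}0$ are rows of $A$; (3) $01^{n-1}$ and $(-1)^{n-1}0$ are rows of $A$; (4) $0(-1)^{n-1}$ and $1^{n-1}0$ are rows of $A$; (5) $1^p0(-1)^{n-p-1}$ and $1^q0(-1)^{n-q-1}$ are rows of $A$ for some $0\le p<q\le n-1$.
   Context: Rows of matrices are written as strings of length $n$; $x^r$ denotes the symbol $x$ repeated $r$ times. For an $m\times n$ matrix $M=[m_{ij}]$ over $\{ -1,0,1\}$, $G_o(M)$ is the directed graph on $\{1,\dots,n+m\}$ with edges $j\to i$ for all $1\le j<i\le n$, and for $1\le p\le m$, $1\le j\le n$: an edge $j\to n+p$ if $m_{pj}=1$, an edge $n+p\to j$ if $m_{pj}=-1$, no edge if $m_{pj}=0$; no edges among $n+1,\dots,n+m$. A directed graph is semi-transitive if it is acyclic and for every directed path $u_1\to\cdots\to u_t$, $t\ge2$, either there is no edge $u_1\to u_t$ or all edges $u_i\to u_j$ ($1\le i<j\le t$) exist. For $m\times n$ matrices $A,B,C$ over $\{ -1,0,1\}$, the morphism $\varphi$ replaces each entry $0,1,-1$ by the block $A,B,C$ respectively; $M^k(A,B,C)=\varphi^k([0])$ and $G_o^k(A,B,C)=G_o(M^k(A,B,C))$.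 If $A$ has an entry $0$, ${\rm IST}(A,B,C)$ is the least $\ell\ge0$ with $G_o^\ell(A,B,C)$ not semi-transitive, or $\infty$ if none exists. $(A,B,C)$ is independent from $B$ if there are no $1$'s in $A$ and $C$; it is independent from $C$ if there are no $(-1)$'s in $A$ and $B$. -}

module Defs where

open import Data.Nat using (ℕ; zero; suc; _^_; _<_)
open import Data.Fin using (Fin; toℕ; remQuot)
open import Data.Product using (Σ; ∃; _×_; _,_)
open import Data.Sum using (_⊎_; inj₁; inj₂)
open import Data.List using (List; []; _∷_; _++_)
open import Data.List.Relation.Unary.Linked using (Linked)
open import Data.List.Relation.Unary.AllPairs using (AllPairs)
open import Data.Empty using (⊥)
open import Relation.Nullary using (¬_; yes; no)
open import Relation.Binary using (tri<; tri≈; tri>)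
open import Data.Nat.Properties using (<-cmp)
open import Data.Nat using (_≟_)
open import Relation.Binary.PropositionalEquality using (_≡_; _≢_)

data Entry : Set where
  neg zer pos : Entry

Mat : ℕ → ℕ → Set
Mat r c = Fin r → Fin c → Entry

Graph : Set → Set₁
Graph V = V → V → Set

-- G_o(M): vertices are the columns 1..c (inj₁) and the rows n+1..n+r (inj₂)
Go : ∀ {r c} → Mat r c → Graph (Fin c ⊎ Fin r)
Go M (inj₁ j) (inj₁ i) = toℕ j < toℕ i
Go M (inj₁ j) (inj₂ p) = M p j ≡ pos
Go M (inj₂ p) (inj₁ j) = M p j ≡ neg
Go M (inj₂ p) (inj₂ q) = ⊥

Acyclic : ∀ {V} → Graph V → Set
Acyclic {V} E = ¬ (Σ V λ u → Σ (List V) λ mid → Linked E (u ∷ mid ++ u ∷ []))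

SemiTransitive : ∀ {V} → Graph V → Set
SemiTransitive {V} E =
  Acyclic E ×
  ((u v : V) (mid : List V) → Linked E (u ∷ mid ++ v ∷ []) → E u v →
     AllPairs E (u ∷ mid ++ v ∷ []))

module Morphism {m n : ℕ} (A B C : Mat m n) where

  block : Entry → Mat m n
  block zer = A
  block pos = B
  block neg = C

  -- φ^k([x]) : an m^k × n^k matrix.  φ^(k+1)([x]) = φ^k(block x), whose
  -- (i1,j1) block (of size m^k × n^k) is φ^k([ (block x) i1 j1 ]).
  φ^[_] : (k : ℕ) → Entry → Mat (m ^ k) (n ^ k)
  φ^[ zero  ] x i j = x
  φ^[ suc k ] x i j with remQuot (m ^ k) i | remQuot (n ^ k) j
  ... | i1 , i2 | j1 , j2 = φ^[ k ] (block x i1 j1) i2 j2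

Mk : ∀ {m n} → Mat m n → Mat m n → Mat m n → (k : ℕ) → Mat (m ^ k) (n ^ k)
Mk A B C k = Morphism.φ^[_] A B C k zer

Gok : ∀ {m n} → Mat m n → Mat m n → Mat m n → (k : ℕ) → Graph (Fin (n ^ k) ⊎ Fin (m ^ k))
Gok A B C k = Go (Mk A B C k)

-- IST(A,B,C) is finite: some G_o^ℓ(A,B,C) is not semi-transitive
-- (then the least such ℓ exists and equals IST(A,B,C) < ∞)
ISTFinite : ∀ {m n} → Mat m n → Mat m n → Mat m n → Set
ISTFinite A B C = ∃ λ ℓ → ¬ SemiTransitive (Gok A B C ℓ)

HasZero : ∀ {m n} → Mat m n → Set
HasZero {m} {n} A = Σ (Fin m) λ i → Σ (Fin n) λ j → A i j ≡ zer

IndepB : ∀ {m n} → Mat m n → Mat m n → Mat m n → Set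
IndepB A B C = ∀ i j → (A i j ≢ pos) × (C i j ≢ pos)

IndepC : ∀ {m n} → Mat m n → Mat m n → Mat m n → Set
IndepC A B C = ∀ i j → (A i j ≢ neg) × (B i j ≢ neg)

IsRow : ∀ {m n} → Mat m n → (ℕ → Entry) → Set
IsRow {m} {n} A r = Σ (Fin m) λ p → (j : Fin n) → A p j ≡ r (toℕ j)

-- 0 x^(n-1)   (0-based index 0 is 0, the rest x)
zeroThen : Entry → ℕ → Entry
zeroThen x zero    = zer
zeroThen x (suc _) = x

-- x^(n-1) 0   (last index n-1 is 0, the rest x)
thenZero : ℕ → Entry → ℕ → Entry
thenZero n x j with _≟_ (suc j) n
... | yes _ = zer
... | no  _ = x

-- 1^p 0 (-1)^(n-p-1)
onesZeroNegs : ℕ → ℕ → Entry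
onesZeroNegs p j with <-cmp j p
... | tri< _ _ _ = pos
... | tri≈ _ _ _ = zer
... | tri> _ _ _ = neg

{-# OPTIONS --safe #-}
-- In each case there are rows r₀, r₁ and columns c₀ < c₁ on which A restricts to an
-- antidiagonal window [0 x; y 0] with x, y ≠ 0. The morphism commutes with restriction to
-- such a window (on k-letter words over {r₀, r₁} and {c₀, c₁}), and the column map stays
-- increasing, so G_o^k of the window is a full subgraph of G_o^k(A,B,C) up to relabelling;
-- semi-transitivity passes to full subgraphs. For the 2 × 2 window, splitting on one or two
-- entries of B or C exhibits in G_o^2 or G_o^3 a cycle or a path whose shortcut does not
-- force all its chords.
module Submission where

open import Defs
open import Data.Nat using (ℕ; zero; suc; _≤_; _∸_; _^_; _*_; _<ᵇ_; _≟_; s≤s; z≤n; z<s)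
  renaming (_<_ to _<ℕ_)
open import Data.Nat.Properties using (<ᵇ⇒<; +-monoʳ-<)
import Data.Nat.Properties as ℕ
open import Data.Fin using (Fin; toℕ; combine; remQuot; fromℕ<; _<_; #_)
  renaming (zero to fzero; suc to fsuc)
open import Data.Fin.Properties
  using (<-cmp; <-irrefl; <-asym; remQuot-combine; combine-remQuot; toℕ-combine;
         combine-monoˡ-<; toℕ-fromℕ<)
open import Data.Vec using (lookup; []; _∷_)
open import Data.List using ([]; _∷_; _++_; map)
open import Data.List.Properties using (map-++)
open import Data.List.Relation.Unary.Linked using (Linked; [-]; _∷_)
import Data.List.Relation.Unary.Linked as Linked
import Data.List.Relation.Unary.Linked.Properties as Linked
open import Data.List.Relation.Unary.AllPairs using (AllPairs; _∷_)
import Data.List.Relation.Unary.AllPairs as AllPairs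
import Data.List.Relation.Unary.AllPairs.Properties as AllPairs
open import Data.List.Relation.Unary.All using ([]; _∷_)
open import Data.Product using (Σ; _×_; _,_; proj₁; proj₂; uncurry)
import Data.Product as Product
open import Data.Sum using (_⊎_; inj₁; inj₂)
import Data.Sum as Sum
open import Data.Bool using (T)
open import Function using (_∘_; id; _⇔_; mk⇔; Equivalence)
open import Relation.Nullary using (¬_; yes; no)
open import Data.Empty using (⊥-elim)
open import Relation.Binary using (_Preserves_⟶_; tri<; tri≈; tri>)
open import Relation.Binary.PropositionalEquality
  using (_≡_; _≢_; refl; sym; trans; cong; cong₂; subst; subst₂; module ≡-Reasoning)

FullHomomorphism : ∀ {V W} → Graph V → Graph W → (V → W) → Set
FullHomomorphism E F f = ∀ u v → E u v ⇔ F (f u) (f v)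

module _ {V W : Set} {E : Graph V} {F : Graph W} {f : V → W}
         (hom : FullHomomorphism E F f) where

  private
    preserve : ∀ {u v} → E u v → F (f u) (f v)
    preserve {u} {v} = Equivalence.to (hom u v)

    reflect : ∀ {u v} → F (f u) (f v) → E u v
    reflect {u} {v} = Equivalence.from (hom u v)

    map-path : ∀ u mid v → map f (u ∷ mid ++ v ∷ []) ≡ f u ∷ map f mid ++ f v ∷ []
    map-path u mid v = cong (f u ∷_) (map-++ f mid (v ∷ []))

    push : ∀ {u mid v} → Linked E (u ∷ mid ++ v ∷ []) → Linked F (f u ∷ map f mid ++ f v ∷ [])
    push {u} {mid} {v} = subst (Linked F) (map-path u mid v) ∘ Linked.map⁺ ∘ Linked.map preserve

    pull : ∀ {u mid v} → AllPairs F (f u ∷ map f mid ++ f v ∷ []) → AllPairs E (u ∷ mid ++ v ∷ [])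
    pull {u} {mid} {v} = AllPairs.map reflect ∘ AllPairs.map⁻ ∘ subst (AllPairs F) (sym (map-path u mid v))

  semiTransitive-pullback : SemiTransitive F → SemiTransitive E
  semiTransitive-pullback (acyclic , shortcut) =
    (λ (u , mid , cycle) → acyclic (f u , map f mid , push cycle)) ,
    (λ u v mid path uv → pull (shortcut (f u) (f v) (map f mid) (push path) (preserve uv)))

preserves-<⇒reflects-< : ∀ {a b} {f : Fin a → Fin b} → f Preserves _<_ ⟶ _<_ →
                         ∀ {i j} → f i < f j → i < j
preserves-<⇒reflects-< f-mono {i} {j} fi<fj with <-cmp i j
... | tri< i<j _ _ = i<j
... | tri≈ _ refl _ = ⊥-elim (<-irrefl refl fi<fj)
... | tri> _ _ j<i = ⊥-elim (<-asym fi<fj (f-mono j<i))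

combine-monoʳ-< : ∀ {a b} (i : Fin a) {j k : Fin b} → j < k → combine i j < combine i k
combine-monoʳ-< {b = b} i {j} {k} j<k
  rewrite toℕ-combine i j | toℕ-combine i k = +-monoʳ-< (b * toℕ i) j<k

combine-<⇒lex : ∀ {a b} {i₁ j₁ : Fin a} {i₂ j₂ : Fin b} → combine i₁ i₂ < combine j₁ j₂ →
                i₁ < j₁ ⊎ (i₁ ≡ j₁ × i₂ < j₂)
combine-<⇒lex {i₁ = i₁} {j₁} {i₂} {j₂} c<c with <-cmp i₁ j₁
... | tri< i₁<j₁ _ _ = inj₁ i₁<j₁
... | tri≈ _ refl _ = inj₂ (refl , preserves-<⇒reflects-< (combine-monoʳ-< i₁) c<c)
... | tri> _ _ j₁<i₁ = ⊥-elim (<-asym c<c (combine-monoˡ-< j₂ i₂ j₁<i₁))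

lex⇒combine-< : ∀ {a b} {i₁ j₁ : Fin a} {i₂ j₂ : Fin b} →
                i₁ < j₁ ⊎ (i₁ ≡ j₁ × i₂ < j₂) → combine i₁ i₂ < combine j₁ j₂
lex⇒combine-< (inj₁ i₁<j₁) = combine-monoˡ-< _ _ i₁<j₁
lex⇒combine-< {i₁ = i₁} (inj₂ (refl , i₂<j₂)) = combine-monoʳ-< i₁ i₂<j₂

lift^[_] : ∀ {a b} k → (Fin a → Fin b) → Fin (a ^ k) → Fin (b ^ k)
lift^[ zero  ] f i = i
lift^[_] {a} (suc k) f i = uncurry combine (Product.map f (lift^[ k ] f) (remQuot {a} (a ^ k) i))

lift-preserves-< : ∀ {a b} k {f : Fin a → Fin b} → f Preserves _<_ ⟶ _<_ →
                   lift^[ k ] f Preserves _<_ ⟶ _<_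
lift-preserves-< zero _ {fzero} {fzero} ()
lift-preserves-< {a} (suc k) {f} f-mono {i} {j} i<j =
  lex⇒combine-< (Sum.map f-mono (Product.map (cong f) (lift-preserves-< k f-mono))
                          (combine-<⇒lex digits<))
  where
  digits< : uncurry combine (remQuot {a} (a ^ k) i) < uncurry combine (remQuot {a} (a ^ k) j)
  digits< = subst₂ _<_ (sym (combine-remQuot {a} (a ^ k) i)) (sym (combine-remQuot {a} (a ^ k) j)) i<j

IsSubmatrix : ∀ {R N R′ N′} → Mat R′ N′ → Mat R N → (Fin R′ → Fin R) → (Fin N′ → Fin N) → Set
IsSubmatrix M′ M ρ κ = ∀ p j → M′ p j ≡ M (ρ p) (κ j)

Go-submatrix : ∀ {R N R′ N′} {M : Mat R N} {M′ : Mat R′ N′} {ρ κ} →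
               IsSubmatrix M′ M ρ κ → κ Preserves _<_ ⟶ _<_ →
               FullHomomorphism (Go M′) (Go M) (Sum.map κ ρ)
Go-submatrix sub κ-mono (inj₁ j) (inj₁ i) = mk⇔ κ-mono (preserves-<⇒reflects-< κ-mono)
Go-submatrix sub κ-mono (inj₁ j) (inj₂ p) = mk⇔ (trans (sym (sub p j))) (trans (sub p j))
Go-submatrix sub κ-mono (inj₂ p) (inj₁ j) = mk⇔ (trans (sym (sub p j))) (trans (sub p j))
Go-submatrix sub κ-mono (inj₂ p) (inj₂ q) = mk⇔ id id

module _ {m n m′ n′} {A B C : Mat m n} {A′ B′ C′ : Mat m′ n′} {ρ κ}
         (subA : IsSubmatrix A′ A ρ κ) (subB : IsSubmatrix B′ B ρ κ) (subC : IsSubmatrix C′ C ρ κ)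
         where

  private
    module Φ = Morphism A B C
    module Φ′ = Morphism A′ B′ C′

    block-submatrix : ∀ x → IsSubmatrix (Φ′.block x) (Φ.block x) ρ κ
    block-submatrix zer = subA
    block-submatrix pos = subB
    block-submatrix neg = subC

  φ-submatrix : ∀ k x → IsSubmatrix (Φ′.φ^[ k ] x) (Φ.φ^[ k ] x) (lift^[ k ] ρ) (lift^[ k ] κ)
  φ-submatrix zero x p j = refl
  φ-submatrix (suc k) x p j = begin
    Φ′.φ^[ k ] (Φ′.block x p₁ j₁) p₂ j₂
      ≡⟨ φ-submatrix k _ p₂ j₂ ⟩
    Φ.φ^[ k ] (Φ′.block x p₁ j₁) (lift^[ k ] ρ p₂) (lift^[ k ] κ j₂)
      ≡⟨ cong (λ y → Φ.φ^[ k ] y (lift^[ k ] ρ p₂) (lift^[ k ] κ j₂)) (block-submatrix x p₁ j₁) ⟩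
    Φ.φ^[ k ] (Φ.block x (ρ p₁) (κ j₁)) (lift^[ k ] ρ p₂) (lift^[ k ] κ j₂)
      ≡⟨ cong₂ (λ (r₁ , r₂) (c₁ , c₂) → Φ.φ^[ k ] (Φ.block x r₁ c₁) r₂ c₂)
               (remQuot-combine (ρ p₁) (lift^[ k ] ρ p₂))
               (remQuot-combine (κ j₁) (lift^[ k ] κ j₂)) ⟨
    Φ.φ^[ suc k ] x (lift^[ suc k ] ρ p) (lift^[ suc k ] κ j) ∎
    where
    open ≡-Reasoning
    p₁ : Fin m′
    p₁ = proj₁ (remQuot {m′} (m′ ^ k) p)
    p₂ : Fin (m′ ^ k)
    p₂ = proj₂ (remQuot {m′} (m′ ^ k) p)
    j₁ : Fin n′
    j₁ = proj₁ (remQuot {n′} (n′ ^ k) j)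
    j₂ : Fin (n′ ^ k)
    j₂ = proj₂ (remQuot {n′} (n′ ^ k) j)

  ISTFinite-submatrix : κ Preserves _<_ ⟶ _<_ → ISTFinite A′ B′ C′ → ISTFinite A B C
  ISTFinite-submatrix κ-mono (ℓ , ¬st) =
    ℓ , ¬st ∘ semiTransitive-pullback (Go-submatrix (φ-submatrix ℓ zer) (lift-preserves-< ℓ κ-mono))

module _ {R N} (M : Mat R N) where

  pos-gap⇒¬semiTransitive : ∀ v a b c → a < b → b < c →
    M v a ≡ pos → M v b ≢ pos → M v c ≡ pos → ¬ SemiTransitive (Go M)
  pos-gap⇒¬semiTransitive v a b c a<b b<c va ¬vb vc (_ , shortcut)
    with shortcut (inj₁ a) (inj₂ v) (inj₁ b ∷ inj₁ c ∷ []) (a<b ∷ b<c ∷ vc ∷ [-]) va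
  ... | _ ∷ (_ ∷ vb ∷ []) ∷ _ = ¬vb vb

  neg-gap⇒¬semiTransitive : ∀ v a b c → a < b → b < c →
    M v a ≡ neg → M v b ≢ neg → M v c ≡ neg → ¬ SemiTransitive (Go M)
  neg-gap⇒¬semiTransitive v a b c a<b b<c va ¬vb vc (_ , shortcut)
    with shortcut (inj₂ v) (inj₁ c) (inj₁ a ∷ inj₁ b ∷ []) (va ∷ a<b ∷ b<c ∷ [-]) vc
  ... | (_ ∷ vb ∷ _) ∷ _ = ¬vb vb

  pos-neg-after⇒¬semiTransitive : ∀ v d a c → d < a → d < c →
    M v d ≢ pos → M v a ≡ pos → M v c ≡ neg → ¬ SemiTransitive (Go M)
  pos-neg-after⇒¬semiTransitive v d a c d<a d<c ¬vd va vc (_ , shortcut)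
    with shortcut (inj₁ d) (inj₁ c) (inj₁ a ∷ inj₂ v ∷ []) (d<a ∷ va ∷ vc ∷ [-]) d<c
  ... | (_ ∷ dv ∷ _) ∷ _ = ¬vd dv

  neg-before-pos⇒¬acyclic : ∀ v a c → a < c → M v a ≡ neg → M v c ≡ pos → ¬ Acyclic (Go M)
  neg-before-pos⇒¬acyclic v a c a<c va vc acyclic =
    acyclic (inj₂ v , inj₁ a ∷ inj₁ c ∷ [] , va ∷ a<c ∷ vc ∷ [-])

  two-rows⇒¬semiTransitive : ∀ v w a c →
    M v a ≡ pos → M v c ≡ neg → M w a ≡ pos → M w c ≡ pos → ¬ SemiTransitive (Go M)
  two-rows⇒¬semiTransitive v w a c va vc wa wc (_ , shortcut)
    with shortcut (inj₁ a) (inj₂ w) (inj₂ v ∷ inj₁ c ∷ []) (va ∷ vc ∷ wc ∷ [-]) wa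
  ... | _ ∷ (_ ∷ () ∷ []) ∷ _

mat₂ : Entry → Entry → Entry → Entry → Mat 2 2
mat₂ a₀₀ a₀₁ a₁₀ a₁₁ fzero        fzero        = a₀₀
mat₂ a₀₀ a₀₁ a₁₀ a₁₁ fzero        (fsuc fzero) = a₀₁
mat₂ a₀₀ a₀₁ a₁₀ a₁₁ (fsuc fzero) fzero        = a₁₀
mat₂ a₀₀ a₀₁ a₁₀ a₁₁ (fsuc fzero) (fsuc fzero) = a₁₁

<-by-computation : ∀ {m n} {m<n : T (m <ᵇ n)} → m <ℕ n
<-by-computation {m} {n} {m<n} = <ᵇ⇒< m n m<n

-- Vertex # i of level k is the base-2 word of i, its leading digit indexing the outermost
-- block: in G_o^3, column # 5 = 101 is the word c₁ c₀ c₁.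
mat₂-antidiagonal-ISTFinite :
  ∀ {a₀₀ a₀₁ a₁₀ a₁₁ b₀₀ b₀₁ b₁₀ b₁₁ c₀₀ c₀₁ c₁₀ c₁₁} →
  a₀₀ ≡ zer → a₀₁ ≢ zer → a₁₀ ≢ zer → a₁₁ ≡ zer →
  ISTFinite (mat₂ a₀₀ a₀₁ a₁₀ a₁₁) (mat₂ b₀₀ b₀₁ b₁₀ b₁₁) (mat₂ c₀₀ c₀₁ c₁₀ c₁₁)
mat₂-antidiagonal-ISTFinite {a₀₁ = zer} _ a₀₁≢0 _ _ = ⊥-elim (a₀₁≢0 refl)
mat₂-antidiagonal-ISTFinite {a₁₀ = zer} _ _ a₁₀≢0 _ = ⊥-elim (a₁₀≢0 refl)
mat₂-antidiagonal-ISTFinite {a₀₁ = pos} {pos} {b₀₀ = neg} refl _ _ refl =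
  2 , pos-neg-after⇒¬semiTransitive _ (# 0) (# 0) (# 1) (# 2) <-by-computation <-by-computation (λ ()) refl refl
mat₂-antidiagonal-ISTFinite {a₀₁ = pos} {pos} {b₀₀ = zer} refl _ _ refl =
  3 , pos-gap⇒¬semiTransitive _ (# 0) (# 1) (# 2) (# 5) <-by-computation <-by-computation refl (λ ()) refl
mat₂-antidiagonal-ISTFinite {a₀₁ = pos} {pos} {b₀₀ = pos} refl _ _ refl =
  2 , pos-gap⇒¬semiTransitive _ (# 2) (# 0) (# 2) (# 3) <-by-computation <-by-computation refl (λ ()) refl
mat₂-antidiagonal-ISTFinite {a₀₁ = neg} {neg} {c₀₀ = neg} refl _ _ refl =
  2 , neg-gap⇒¬semiTransitive _ (# 2) (# 0) (# 2) (# 3) <-by-computation <-by-computation refl (λ ()) refl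
mat₂-antidiagonal-ISTFinite {a₀₁ = neg} {neg} {c₀₀ = zer} refl _ _ refl =
  3 , neg-gap⇒¬semiTransitive _ (# 0) (# 1) (# 2) (# 5) <-by-computation <-by-computation refl (λ ()) refl
mat₂-antidiagonal-ISTFinite {a₀₁ = neg} {neg} {c₀₀ = pos} refl _ _ refl =
  2 , neg-before-pos⇒¬acyclic _ (# 0) (# 1) (# 2) <-by-computation refl refl ∘ proj₁
mat₂-antidiagonal-ISTFinite {a₀₁ = pos} {neg} {b₁₀ = neg} refl _ _ refl =
  2 , neg-gap⇒¬semiTransitive _ (# 1) (# 0) (# 1) (# 2) <-by-computation <-by-computation refl (λ ()) refl
mat₂-antidiagonal-ISTFinite {a₀₁ = pos} {neg} {b₁₀ = zer} refl _ _ refl =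
  3 , pos-gap⇒¬semiTransitive _ (# 2) (# 3) (# 4) (# 5) <-by-computation <-by-computation refl (λ ()) refl
mat₂-antidiagonal-ISTFinite {a₀₁ = pos} {neg} {b₁₀ = pos} refl _ _ refl =
  2 , neg-before-pos⇒¬acyclic _ (# 1) (# 0) (# 2) <-by-computation refl refl ∘ proj₁
mat₂-antidiagonal-ISTFinite {a₀₁ = neg} {pos} {b₀₀ = neg} refl _ _ refl =
  2 , neg-gap⇒¬semiTransitive _ (# 2) (# 0) (# 2) (# 3) <-by-computation <-by-computation refl (λ ()) refl
mat₂-antidiagonal-ISTFinite {a₀₁ = neg} {pos} {b₀₀ = zer} refl _ _ refl =
  3 , neg-gap⇒¬semiTransitive _ (# 4) (# 1) (# 4) (# 5) <-by-computation <-by-computation refl (λ ()) refl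
mat₂-antidiagonal-ISTFinite {a₀₁ = neg} {pos} {b₀₀ = pos} {neg} refl _ _ refl =
  2 , neg-gap⇒¬semiTransitive _ (# 2) (# 1) (# 2) (# 3) <-by-computation <-by-computation refl (λ ()) refl
mat₂-antidiagonal-ISTFinite {a₀₁ = neg} {pos} {b₀₀ = pos} {zer} refl _ _ refl =
  3 , neg-gap⇒¬semiTransitive _ (# 4) (# 3) (# 4) (# 5) <-by-computation <-by-computation refl (λ ()) refl
mat₂-antidiagonal-ISTFinite {a₀₁ = neg} {pos} {b₀₀ = pos} {pos} refl _ _ refl =
  3 , two-rows⇒¬semiTransitive _ (# 2) (# 4) (# 0) (# 3) refl refl refl refl

window : ∀ {m n} → Mat m n → Fin m → Fin m → Fin n → Fin n → Mat 2 2
window M r₀ r₁ c₀ c₁ = mat₂ (M r₀ c₀) (M r₀ c₁) (M r₁ c₀) (M r₁ c₁)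

window-submatrix : ∀ {m n} (M : Mat m n) r₀ r₁ c₀ c₁ →
  IsSubmatrix (window M r₀ r₁ c₀ c₁) M (lookup (r₀ ∷ r₁ ∷ [])) (lookup (c₀ ∷ c₁ ∷ []))
window-submatrix M r₀ r₁ c₀ c₁ fzero        fzero        = refl
window-submatrix M r₀ r₁ c₀ c₁ fzero        (fsuc fzero) = refl
window-submatrix M r₀ r₁ c₀ c₁ (fsuc fzero) fzero        = refl
window-submatrix M r₀ r₁ c₀ c₁ (fsuc fzero) (fsuc fzero) = refl

lookup-pair-preserves-< : ∀ {n} {c₀ c₁ : Fin n} → c₀ < c₁ → lookup (c₀ ∷ c₁ ∷ []) Preserves _<_ ⟶ _<_
lookup-pair-preserves-< c₀<c₁ {fzero}      {fsuc fzero} _ = c₀<c₁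
lookup-pair-preserves-< c₀<c₁ {fsuc fzero} {fsuc fzero} (s≤s ())

antidiagonal-submatrix⇒ISTFinite : ∀ {m n} {A B C : Mat m n} r₀ r₁ {c₀ c₁} → c₀ < c₁ →
  A r₀ c₀ ≡ zer → A r₀ c₁ ≢ zer → A r₁ c₀ ≢ zer → A r₁ c₁ ≡ zer → ISTFinite A B C
antidiagonal-submatrix⇒ISTFinite {A = A} {B} {C} r₀ r₁ {c₀} {c₁} c₀<c₁ a₀₀ a₀₁ a₁₀ a₁₁ =
  ISTFinite-submatrix (window-submatrix A r₀ r₁ c₀ c₁) (window-submatrix B r₀ r₁ c₀ c₁)
                      (window-submatrix C r₀ r₁ c₀ c₁) (lookup-pair-preserves-< c₀<c₁)
                      (mat₂-antidiagonal-ISTFinite a₀₀ a₀₁ a₁₀ a₁₁)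

thenZero-last : ∀ n x → thenZero (suc n) x n ≡ zer
thenZero-last n x with suc n ≟ suc n
... | yes _ = refl
... | no sn≢sn = ⊥-elim (sn≢sn refl)

onesZeroNegs-diag : ∀ p → onesZeroNegs p p ≡ zer
onesZeroNegs-diag p with ℕ.<-cmp p p
... | tri< p<p _ _ = ⊥-elim (ℕ.<-irrefl refl p<p)
... | tri≈ _ _ _ = refl
... | tri> _ _ p>p = ⊥-elim (ℕ.<-irrefl refl p>p)

onesZeroNegs-off-diag : ∀ {p j} → j ≢ p → onesZeroNegs p j ≢ zer
onesZeroNegs-off-diag {p} {j} j≢p with ℕ.<-cmp j p
... | tri< _ _ _ = λ ()
... | tri≈ _ j≡p _ = ⊥-elim (j≢p j≡p)
... | tri> _ _ _ = λ ()

row-entry : ∀ {m n} {A : Mat m n} r ((p , row) : IsRow A r) →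
            ∀ {t} (t<n : t <ℕ n) → A p (fromℕ< t<n) ≡ r t
row-entry r (_ , row) t<n = trans (row _) (cong r (toℕ-fromℕ< t<n))

fromℕ<-mono-< : ∀ {n s t} (s<n : s <ℕ n) (t<n : t <ℕ n) → s <ℕ t → fromℕ< s<n < fromℕ< t<n
fromℕ<-mono-< s<n t<n = subst₂ _<ℕ_ (sym (toℕ-fromℕ< s<n)) (sym (toℕ-fromℕ< t<n))

≢zer-by : ∀ {a b} → a ≡ b → b ≢ zer → a ≢ zer
≢zer-by a≡b b≢0 a≡0 = b≢0 (trans (sym a≡b) a≡0)

zeroThen-thenZero⇒ISTFinite : ∀ {m k} {A B C : Mat m (suc (suc k))} {x y} → x ≢ zer → y ≢ zer →
  IsRow A (zeroThen x) → IsRow A (thenZero (suc (suc k)) y) → ISTFinite A B C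
zeroThen-thenZero⇒ISTFinite {k = k} {x = x} {y} x≢0 y≢0 row₀ row₁ =
  antidiagonal-submatrix⇒ISTFinite (proj₁ row₀) (proj₁ row₁) (fromℕ<-mono-< first last z<s)
    (row-entry (zeroThen x) row₀ first) (≢zer-by (row-entry (zeroThen x) row₀ last) x≢0)
    (≢zer-by (row-entry (thenZero (suc (suc k)) y) row₁ first) y≢0) (trans (row-entry (thenZero (suc (suc k)) y) row₁ last) (thenZero-last (suc k) y))
  where
  first : 0 <ℕ suc (suc k)
  first = z<s
  last : suc k <ℕ suc (suc k)
  last = ℕ.n<1+n (suc k)

onesZeroNegs⇒ISTFinite : ∀ {m n} {A B C : Mat m n} {p q} → p <ℕ q → q <ℕ n →
  IsRow A (onesZeroNegs p) → IsRow A (onesZeroNegs q) → ISTFinite A B C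
onesZeroNegs⇒ISTFinite {n = n} {p = p} {q} p<q q<n row₀ row₁ =
  antidiagonal-submatrix⇒ISTFinite (proj₁ row₀) (proj₁ row₁) (fromℕ<-mono-< p<n q<n p<q)
    (trans (row-entry (onesZeroNegs p) row₀ p<n) (onesZeroNegs-diag p))
    (≢zer-by (row-entry (onesZeroNegs p) row₀ q<n) (onesZeroNegs-off-diag (ℕ.>⇒≢ p<q)))
    (≢zer-by (row-entry (onesZeroNegs q) row₁ p<n) (onesZeroNegs-off-diag (ℕ.<⇒≢ p<q)))
    (trans (row-entry (onesZeroNegs q) row₁ q<n) (onesZeroNegs-diag q))
  where
  p<n : p <ℕ n
  p<n = ℕ.<-trans p<q q<n

lemma3p18 : (m n : ℕ) → 2 ≤ n → (A B C : Mat m n) →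
    HasZero A → ¬ IndepB A B C → ¬ IndepC A B C →
    ((IsRow A (zeroThen pos) × IsRow A (thenZero n pos)) ⊎
     ((IsRow A (zeroThen neg) × IsRow A (thenZero n neg)) ⊎
      ((IsRow A (zeroThen pos) × IsRow A (thenZero n neg)) ⊎
       ((IsRow A (zeroThen neg) × IsRow A (thenZero n pos)) ⊎
        Σ ℕ λ p → Σ ℕ λ q → p <ℕ q × q ≤ n ∸ 1 ×
          IsRow A (onesZeroNegs p) × IsRow A (onesZeroNegs q))))) →
    ISTFinite A B C
lemma3p18 m (suc (suc k)) (s≤s (s≤s z≤n)) A B C _ _ _ = λ where
  (inj₁ (row₀ , row₁)) → zeroThen-thenZero⇒ISTFinite (λ ()) (λ ()) row₀ row₁
  (inj₂ (inj₁ (row₀ , row₁))) → zeroThen-thenZero⇒ISTFinite (λ ()) (λ ()) row₀ row₁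
  (inj₂ (inj₂ (inj₁ (row₀ , row₁)))) → zeroThen-thenZero⇒ISTFinite (λ ()) (λ ()) row₀ row₁
  (inj₂ (inj₂ (inj₂ (inj₁ (row₀ , row₁))))) → zeroThen-thenZero⇒ISTFinite (λ ()) (λ ()) row₀ row₁
  (inj₂ (inj₂ (inj₂ (inj₂ (p , q , p<q , q≤1+k , row₀ , row₁))))) →
    onesZeroNegs⇒ISTFinite p<q (s≤s q≤1+k) row₀ row₁
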